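{- Let $n$ be a positive integer and $\vec n=x_1\cdots x_k\in\mathcal H(n)$. The outdegree of $\vec n$ in $A(n)$ (its number of children) equals the number of maximal blocks of consecutive $2$'s in $\vec n$.
   Context: A hyperbinary expansion of a positive integer $n$ is a word $x_1\cdots x_k$ over $\{0,1,2\}$ with $x_1\neq 0$ and $n=\sum_{i=1}^k x_i2^{k-i}$; $\mathcal H(n)$ is the set of these. Words are regarded up to leading zeros. Single-step reductions are: (I) $2\vec y \to 1\,0\,\vec y$; (II) $\vec x\,0\,2\,\vec y\to \vec x\,1\,0\,\vec y$; (III) $\vec x\,1\,2\,\vec y \twoheadrightarrow \vec x\,2\,0\,\vec y$, for words $\vec x,\vec y$ over $\{0,1,2\}$. If $\vec u$ is transformed into $\vec v$ by one single-step reduction, $\vec v$ is a child of $\vec u$. $A(n)$ is the directed graph with vertex set $\mathcal H(n)$ and an arc from $\vec u$ to $\vec v$ iff $\vec v$ is a child of $\vec u$. -}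

module Defs where

open import Data.Nat using (ℕ; zero; suc; _+_; _*_)
open import Data.List using (List; []; _∷_; _++_; foldl)
open import Data.Product using (Σ; _×_; ∃)
open import Relation.Binary.PropositionalEquality using (_≡_; _≢_)

data Digit : Set where
  d0 d1 d2 : Digit

digitVal : Digit → ℕ
digitVal d0 = 0
digitVal d1 = 1
digitVal d2 = 2

-- a word x₁ ⋯ x_k over {0,1,2}, x₁ first (most significant)
Word : Set
Word = List Digit

value : Word → ℕ
value = foldl (λ acc d → 2 * acc + digitVal d) 0

LeadingNonzero : Word → Set
LeadingNonzero w = Σ Digit λ d → Σ Word λ rest → (w ≡ d ∷ rest) × (d ≢ d0)

Hyperbinary : ℕ → Word → Set
Hyperbinary n w = LeadingNonzero w × (value w ≡ n)

-- single-step reductions: Step u v  means  v is a child of u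
data Step : Word → Word → Set where
  ruleI   : (y : Word)     → Step (d2 ∷ y) (d1 ∷ d0 ∷ y)
  ruleII  : (x y : Word)   → Step (x ++ d0 ∷ d2 ∷ y) (x ++ d1 ∷ d0 ∷ y)
  ruleIII : (x y : Word)   → Step (x ++ d1 ∷ d2 ∷ y) (x ++ d2 ∷ d0 ∷ y)

-- number of maximal blocks of consecutive 2's (each block counted at its last letter)
blocks2 : Word → ℕ
blocks2 []              = 0
blocks2 (d2 ∷ d2 ∷ w)   = blocks2 (d2 ∷ w)
blocks2 (d2 ∷ w)        = suc (blocks2 w)
blocks2 (d0 ∷ w)        = blocks2 w
blocks2 (d1 ∷ w)        = blocks2 w

-- A 2 can be rewritten only at the start of a maximal block of 2's: by rule I when it is the
-- first letter, by rule II or III when it follows a 0 or a 1. So every block yields exactly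
-- one child. Each rule is a carry (a 2 in place j becomes a 1 in place j + 1), so it preserves
-- the value, and none of them creates a leading zero; hence all children lie in 𝓗(n).
module Submission where

open import Defs
open import Data.Nat using (ℕ; _<_; suc; _+_; _*_)
open import Data.Nat.Tactic.RingSolver using (solve-∀)
open import Data.List using (List; length; []; _∷_; _++_; map; foldl)
open import Data.List.Properties using (foldl-++; length-++; length-map; ∷-injectiveʳ)
open import Data.List.Relation.Unary.Unique.Propositional using (Unique)
open import Data.List.Relation.Unary.AllPairs as AllPairs using ()
open import Data.List.Relation.Unary.Unique.Propositional.Properties using (++⁺; map⁺)
open import Data.List.Relation.Unary.All as All using ()
open import Data.List.Relation.Unary.Any using (here; there)
open import Data.List.Relation.Binary.Disjoint.Propositional using (Disjoint)
open import Data.List.Membership.Propositional using (_∈_; _∉_)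
open import Data.List.Membership.Propositional.Properties using (∈-map⁺; ∈-map⁻; ∈-++⁺ʳ; ∈-++⁻)
open import Data.Product using (Σ; _×_; _,_; proj₂)
open import Data.Sum using (inj₁; inj₂)
open import Function using (_∘_)
open import Function.Bundles using (_⇔_; mk⇔)
open import Relation.Nullary using (¬_)
open import Relation.Binary.PropositionalEquality using (_≡_; refl; cong; trans; module ≡-Reasoning)

data PrefixStep : Word → Word → Set where
  ruleII  : (y : Word) → PrefixStep (d0 ∷ d2 ∷ y) (d1 ∷ d0 ∷ y)
  ruleIII : (y : Word) → PrefixStep (d1 ∷ d2 ∷ y) (d2 ∷ d0 ∷ y)

-- Step without rule I, the one reduction that is not preserved by putting a letter in front.
data InnerStep : Word → Word → Set where
  at : (x : Word) {u v : Word} → PrefixStep u v → InnerStep (x ++ u) (x ++ v)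

InnerStep-∷ : ∀ d {u v} → InnerStep u v → InnerStep (d ∷ u) (d ∷ v)
InnerStep-∷ d (at x s) = at (d ∷ x) s

InnerStep⇒Step : ∀ {u v} → InnerStep u v → Step u v
InnerStep⇒Step (at x (ruleII y))  = ruleII x y
InnerStep⇒Step (at x (ruleIII y)) = ruleIII x y

PrefixStep-changes-head : ∀ {d w v} → ¬ PrefixStep (d ∷ w) (d ∷ v)
PrefixStep-changes-head ()

prefixReducts : Digit → Word → List Word
prefixReducts d0 (d2 ∷ y) = (d1 ∷ d0 ∷ y) ∷ []
prefixReducts d1 (d2 ∷ y) = (d2 ∷ d0 ∷ y) ∷ []
prefixReducts _  _        = []

innerReducts : Word → List Word
innerReducts []      = []
innerReducts (d ∷ w) = prefixReducts d w ++ map (d ∷_) (innerReducts w)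

children : Word → List Word
children (d2 ∷ y) = (d1 ∷ d0 ∷ y) ∷ innerReducts (d2 ∷ y)
children w        = innerReducts w

∈prefixReducts⇒PrefixStep : ∀ d w {v} → v ∈ prefixReducts d w → PrefixStep (d ∷ w) v
∈prefixReducts⇒PrefixStep d0 (d2 ∷ y) (here refl) = ruleII y
∈prefixReducts⇒PrefixStep d1 (d2 ∷ y) (here refl) = ruleIII y
∈prefixReducts⇒PrefixStep d0 (d2 ∷ _) (there ())
∈prefixReducts⇒PrefixStep d1 (d2 ∷ _) (there ())
∈prefixReducts⇒PrefixStep d0 []       ()
∈prefixReducts⇒PrefixStep d0 (d0 ∷ _) ()
∈prefixReducts⇒PrefixStep d0 (d1 ∷ _) ()
∈prefixReducts⇒PrefixStep d1 []       ()
∈prefixReducts⇒PrefixStep d1 (d0 ∷ _) ()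
∈prefixReducts⇒PrefixStep d1 (d1 ∷ _) ()
∈prefixReducts⇒PrefixStep d2 _        ()

∈innerReducts⇒InnerStep : ∀ u {v} → v ∈ innerReducts u → InnerStep u v
∈innerReducts⇒InnerStep (d ∷ w) p with ∈-++⁻ (prefixReducts d w) p
... | inj₁ q = at [] (∈prefixReducts⇒PrefixStep d w q)
... | inj₂ q with ∈-map⁻ (d ∷_) q
...   | _ , r , refl = InnerStep-∷ d (∈innerReducts⇒InnerStep w r)

InnerStep⇒∈innerReducts : ∀ {u v} → InnerStep u v → v ∈ innerReducts u
InnerStep⇒∈innerReducts (at [] (ruleII y))  = here refl
InnerStep⇒∈innerReducts (at [] (ruleIII y)) = here refl
InnerStep⇒∈innerReducts (at (c ∷ x) {u} s) =
  ∈-++⁺ʳ (prefixReducts c (x ++ u)) (∈-map⁺ (c ∷_) (InnerStep⇒∈innerReducts (at x s)))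

innerReducts⊆children : ∀ u {v} → v ∈ innerReducts u → v ∈ children u
innerReducts⊆children (d0 ∷ _) p = p
innerReducts⊆children (d1 ∷ _) p = p
innerReducts⊆children (d2 ∷ _) p = there p

∈children⇒Step : ∀ u {v} → v ∈ children u → Step u v
∈children⇒Step (d0 ∷ y) p           = InnerStep⇒Step (∈innerReducts⇒InnerStep _ p)
∈children⇒Step (d1 ∷ y) p           = InnerStep⇒Step (∈innerReducts⇒InnerStep _ p)
∈children⇒Step (d2 ∷ y) (here refl) = ruleI y
∈children⇒Step (d2 ∷ y) (there p)   = InnerStep⇒Step (∈innerReducts⇒InnerStep _ p)

Step⇒∈children : ∀ {u v} → Step u v → v ∈ children u
Step⇒∈children (ruleI y)     = here refl
Step⇒∈children (ruleII x y)  =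
  innerReducts⊆children (x ++ d0 ∷ d2 ∷ y) (InnerStep⇒∈innerReducts (at x (ruleII y)))
Step⇒∈children (ruleIII x y) =
  innerReducts⊆children (x ++ d1 ∷ d2 ∷ y) (InnerStep⇒∈innerReducts (at x (ruleIII y)))

Disjoint-map-∷ : ∀ {a} {A : Set a} {d : A} (xs K : List (List A)) →
  (∀ {w} → d ∷ w ∉ xs) → Disjoint xs (map (d ∷_) K)
Disjoint-map-∷ xs K fresh (p , q) with ∈-map⁻ (_ ∷_) q
... | _ , _ , refl = fresh p

Unique-prefixReducts : ∀ d w → Unique (prefixReducts d w)
Unique-prefixReducts d0 (d2 ∷ _) = All.[] AllPairs.∷ AllPairs.[]
Unique-prefixReducts d1 (d2 ∷ _) = All.[] AllPairs.∷ AllPairs.[]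
Unique-prefixReducts d0 []       = AllPairs.[]
Unique-prefixReducts d0 (d0 ∷ _) = AllPairs.[]
Unique-prefixReducts d0 (d1 ∷ _) = AllPairs.[]
Unique-prefixReducts d1 []       = AllPairs.[]
Unique-prefixReducts d1 (d0 ∷ _) = AllPairs.[]
Unique-prefixReducts d1 (d1 ∷ _) = AllPairs.[]
Unique-prefixReducts d2 _        = AllPairs.[]

Unique-innerReducts : ∀ u → Unique (innerReducts u)
Unique-innerReducts []      = AllPairs.[]
Unique-innerReducts (d ∷ w) =
  ++⁺ (Unique-prefixReducts d w) (map⁺ ∷-injectiveʳ (Unique-innerReducts w))
      (Disjoint-map-∷ (prefixReducts d w) (innerReducts w)
        (PrefixStep-changes-head ∘ ∈prefixReducts⇒PrefixStep d w))

Unique-children : ∀ u → Unique (children u)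
Unique-children []       = AllPairs.[]
Unique-children (d0 ∷ y) = Unique-innerReducts (d0 ∷ y)
Unique-children (d1 ∷ y) = Unique-innerReducts (d1 ∷ y)
Unique-children (d2 ∷ y) =
  ++⁺ (All.[] AllPairs.∷ AllPairs.[]) (Unique-innerReducts (d2 ∷ y))
      (Disjoint-map-∷ _ (innerReducts y) fresh)
  where
  fresh : ∀ {w} → d2 ∷ w ∉ (d1 ∷ d0 ∷ y) ∷ []
  fresh (here ())
  fresh (there ())

-- For d ≠ 2, the reduct of d ∷ y at its front replaces the rule I child of y.
length-prefixReducts : ∀ d y → ¬ d ≡ d2 →
  length (prefixReducts d y) + length (innerReducts y) ≡ length (children y)
length-prefixReducts d0 []       _ = refl
length-prefixReducts d0 (d0 ∷ _) _ = refl
length-prefixReducts d0 (d1 ∷ _) _ = refl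
length-prefixReducts d0 (d2 ∷ _) _ = refl
length-prefixReducts d1 []       _ = refl
length-prefixReducts d1 (d0 ∷ _) _ = refl
length-prefixReducts d1 (d1 ∷ _) _ = refl
length-prefixReducts d1 (d2 ∷ _) _ = refl
length-prefixReducts d2 _        d≢2 with () ← d≢2 refl

length-innerReducts-∷ : ∀ d y → ¬ d ≡ d2 → length (innerReducts (d ∷ y)) ≡ length (children y)
length-innerReducts-∷ d y d≢2 = begin
  length (prefixReducts d y ++ map (d ∷_) (innerReducts y))         ≡⟨ length-++ (prefixReducts d y) ⟩
  length (prefixReducts d y) + length (map (d ∷_) (innerReducts y))
    ≡⟨ cong (length (prefixReducts d y) +_) (length-map (d ∷_) (innerReducts y)) ⟩
  length (prefixReducts d y) + length (innerReducts y)              ≡⟨ length-prefixReducts d y d≢2 ⟩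
  length (children y)                                               ∎
  where open ≡-Reasoning

length-children : ∀ u → length (children u) ≡ blocks2 u
length-children []            = refl
length-children (d0 ∷ y)      = trans (length-innerReducts-∷ d0 y λ ()) (length-children y)
length-children (d1 ∷ y)      = trans (length-innerReducts-∷ d1 y λ ()) (length-children y)
length-children (d2 ∷ [])     = refl
length-children (d2 ∷ d0 ∷ z) =
  cong suc (trans (length-map (d2 ∷_) (innerReducts (d0 ∷ z))) (length-children (d0 ∷ z)))
length-children (d2 ∷ d1 ∷ z) =
  cong suc (trans (length-map (d2 ∷_) (innerReducts (d1 ∷ z))) (length-children (d1 ∷ z)))
length-children (d2 ∷ d2 ∷ z) =
  trans (cong suc (length-map (d2 ∷_) (innerReducts (d2 ∷ z)))) (length-children (d2 ∷ z))

push : ℕ → Digit → ℕ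
push acc d = 2 * acc + digitVal d

value-++-cong : ∀ x u v y → (∀ a → foldl push a u ≡ foldl push a v) →
  value (x ++ u ++ y) ≡ value (x ++ v ++ y)
value-++-cong x u v y u≗v = begin
  value (x ++ u ++ y)                     ≡⟨ foldl-++ push 0 x (u ++ y) ⟩
  foldl push (value x) (u ++ y)           ≡⟨ foldl-++ push (value x) u y ⟩
  foldl push (foldl push (value x) u) y   ≡⟨ cong (λ a → foldl push a y) (u≗v (value x)) ⟩
  foldl push (foldl push (value x) v) y   ≡⟨ foldl-++ push (value x) v y ⟨
  foldl push (value x) (v ++ y)           ≡⟨ foldl-++ push 0 x (v ++ y) ⟨
  value (x ++ v ++ y)                     ∎
  where open ≡-Reasoning

carry : ∀ a c → 2 * (2 * a + suc c) + 0 ≡ 2 * (2 * a + c) + 2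
carry = solve-∀

value-Step : ∀ {u v} → Step u v → value v ≡ value u
value-Step (ruleI y)     = refl
value-Step (ruleII x y)  = value-++-cong x (d1 ∷ d0 ∷ []) (d0 ∷ d2 ∷ []) y (λ a → carry a 0)
value-Step (ruleIII x y) = value-++-cong x (d2 ∷ d0 ∷ []) (d1 ∷ d2 ∷ []) y (λ a → carry a 1)

LeadingNonzero-Step : ∀ {u v} → Step u v → LeadingNonzero u → LeadingNonzero v
LeadingNonzero-Step (ruleI y)           _                   = d1 , d0 ∷ y , refl , λ ()
LeadingNonzero-Step (ruleII [] y)       (_ , _ , refl , ≢0) with () ← ≢0 refl
LeadingNonzero-Step (ruleII (c ∷ x) y)  (_ , _ , refl , ≢0) = c , _ , refl , ≢0
LeadingNonzero-Step (ruleIII [] y)      _                   = d2 , d0 ∷ y , refl , λ ()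
LeadingNonzero-Step (ruleIII (c ∷ x) y) (_ , _ , refl , ≢0) = c , _ , refl , ≢0

Hyperbinary-Step : ∀ {n u v} → Step u v → Hyperbinary n u → Hyperbinary n v
Hyperbinary-Step s (leads , val) = LeadingNonzero-Step s leads , trans (value-Step s) val

lemma5p2 : (n : ℕ) → 0 < n → (u : Word) → Hyperbinary n u →
    Σ (List Word) λ L →
    Unique L × ((v : Word) → (v ∈ L) ⇔ (Hyperbinary n v × Step u v)) × (length L ≡ blocks2 u)
lemma5p2 n _ u hu = children u , Unique-children u , members , length-children u
  where
  members : (v : Word) → (v ∈ children u) ⇔ (Hyperbinary n v × Step u v)
  members v = mk⇔ (λ p → let s = ∈children⇒Step u p in Hyperbinary-Step s hu , s)
                  (Step⇒∈children ∘ proj₂)
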